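{- For $\gamma \in [\![\Gamma]\!]$: (i) $[\![\Gamma \vdash \bot]\!](\gamma) = \emptyset$; (ii) $[\![\Gamma \vdash A \land B]\!](\gamma) = [\![\Gamma \vdash A]\!](\gamma) \cap [\![\Gamma \vdash B]\!](\gamma)$; (iii) $[\![\Gamma \vdash A \lor B]\!](\gamma) = [\![\Gamma \vdash A]\!](\gamma) \cup [\![\Gamma \vdash B]\!](\gamma)$; (iv) $[\![\Gamma \vdash \exists x:A.Q]\!](\gamma) = \bigcup_{\alpha \in [\![\Gamma \vdash A]\!](\gamma)} [\![\Gamma;(x:A) \vdash Q]\!](\gamma,\alpha)$; (v) if $[\![\Gamma \vdash A \leftrightarrow B]\!](\gamma) = X$ then $[\![\Gamma \vdash A]\!](\gamma) = [\![\Gamma \vdash B]\!](\gamma)$; (vi) if $[\![\Gamma \vdash x =_A y]\!](\gamma) = X$ then $[\![\Gamma \vdash x]\!](\gamma) = [\![\Gamma \vdash y]\!](\gamma)$.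
   Context: Logical symbols are the impredicative encodings in ECC: $A \to B := \forall x:A.B$ ($x$ not free in $B$), $\bot := \forall P:\mathrm{Prop}.P$, $\neg A := A \to \bot$, $A \land B := \forall P:\mathrm{Prop}.(A \to B \to P) \to P$, $A \lor B := \forall P:\mathrm{Prop}.(A \to P) \to (B \to P) \to P$, $\exists x:A.Q := \forall P:\mathrm{Prop}.(\forall x:A.(Q \to P)) \to P$, $A \leftrightarrow B := (A \to B) \land (B \to A)$, $x =_A y := \forall Q:(A \to \mathrm{Prop}).\,Q\,x \leftrightarrow Q\,y$. Model: a topological space $(X,\mathcal{O}(X))$ with reference point $p$ such that $\bigcap\{U \in \mathcal{O}(X) \mid p \in U\}$ is open. $\mathcal{O}(X)$ is a complete Heyting algebra under inclusion: meet of a family $S$ of opens is the interior $(\bigcap S)^\circ$ ($X$ if $S=\emptyset$), binary meet is intersection, joins are unions, exponential $b^a := \bigcup\{t \in \mathcal{O}(X) \mid t \cap a \subseteq b\}$. The interpretation sends $\mathrm{Prop}$ to $\mathcal{O}(X)$, proof terms to $p$; for $\forall x:P.Q$ it gives $([\![\Gamma \vdash Q]\!](\gamma))^{[\![\Gamma \vdash P]\!](\gamma)}$ when $P,Q$ are both propositions (with $x$ not free in $Q$), $\bigl(\bigcap\{[\![\Gamma;(x:P) \vdash Q]\!](\gamma,\alpha) \mid \alpha \in [\![\Gamma \vdash P]\!](\gamma)\}\bigr)^\circ$ (or $X$ if empty) when $P$ is not a proposition but $Q$ is, and the set-theoretic dependent function space over $\alpha \in [\![\Gamma \vdash P]\!](\gamma)$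 (restricted to $\{p\}$ if $P$ is a proposition) otherwise; variables are interpreted by the corresponding component of $\gamma$. -}

module Defs where

open import Data.Empty using (⊥)
open import Data.Unit using (⊤)
open import Data.Product using (Σ; _×_; _,_)
open import Data.Sum using (_⊎_)

Subset : Set → Set₁
Subset X = X → Set

module _ {X : Set} where

  infix 4 _∈_ _⊆_ _≐_
  infixr 6 _∩_
  infixr 5 _∪_

  _∈_ : X → Subset X → Set
  z ∈ A = A z

  _⊆_ : Subset X → Subset X → Set
  A ⊆ B = ∀ z → z ∈ A → z ∈ B

  _≐_ : Subset X → Subset X → Set
  A ≐ B = (A ⊆ B) × (B ⊆ A)

  ∅ : Subset X
  ∅ = λ _ → ⊥

  Whole : Subset X
  Whole = λ _ → ⊤

  _∩_ : Subset X → Subset X → Subset X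
  A ∩ B = λ z → (z ∈ A) × (z ∈ B)

  _∪_ : Subset X → Subset X → Subset X
  A ∪ B = λ z → (z ∈ A) ⊎ (z ∈ B)

  ⋃ : {J : Set} → (J → Subset X) → Subset X
  ⋃ {J} f = λ z → Σ J (λ j → z ∈ f j)

  ⋂ : {J : Set} → (J → Subset X) → Subset X
  ⋂ {J} f = λ z → (j : J) → z ∈ f j

-- O(X) is presented as a family of
-- subsets U : I → Subset X (the index type I ranges over the opens);
-- the topology axioms say the family contains ∅ and X and is closed
-- under binary intersections and arbitrary unions (of any subfamily).

record Space : Set₁ where
  field
    X : Set
    I : Set
    U : I → Subset X
    p : X
    empty-open : Σ I (λ i → U i ≐ ∅)
    whole-open : Σ I (λ i → U i ≐ Whole)
    ∩-open     : (i j : I) → Σ I (λ k → U k ≐ (U i ∩ U j))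
    ⋃-open     : (J : Set) (f : J → I) → Σ I (λ k → U k ≐ ⋃ (λ j → U (f j)))
    ref-open   : Σ I (λ k → U k ≐ ⋂ {J = Σ I (λ i → p ∈ U i)} (λ ip → U (Data.Product.proj₁ ip)))

module Sem (S : Space) where
  open Space S

  int : Subset X → Subset X
  int A = λ z → Σ I (λ t → (U t ⊆ A) × (z ∈ U t))

  -- meet of a family of opens: interior of the intersection
  -- (for the empty family this is int X = X, as X is open)
  meet : {J : Set} → (J → Subset X) → Subset X
  meet f = int (⋂ f)

  -- exponential  b ^ a = ⋃ {t ∈ O(X) | t ∩ a ⊆ b}; interprets  A → B
  infixr 4 _⇒_
  _⇒_ : Subset X → Subset X → Subset X
  a ⇒ b = λ z → Σ I (λ t → ((U t ∩ a) ⊆ b) × (z ∈ U t))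

  -- ⊥ := ∀ P:Prop. P
  ⟦⊥⟧ : Subset X
  ⟦⊥⟧ = meet (λ P → U P)

  -- A ∧ B := ∀ P:Prop. (A → B → P) → P
  ⟦∧⟧ : Subset X → Subset X → Subset X
  ⟦∧⟧ a b = meet (λ P → (a ⇒ (b ⇒ U P)) ⇒ U P)

  -- A ∨ B := ∀ P:Prop. (A → P) → (B → P) → P
  ⟦∨⟧ : Subset X → Subset X → Subset X
  ⟦∨⟧ a b = meet (λ P → (a ⇒ U P) ⇒ ((b ⇒ U P) ⇒ U P))

  -- ∃ x:A. Q := ∀ P:Prop. (∀ x:A. (Q → P)) → P   (A a non-propositional type,
  -- interpreted by the set A; Q interpreted by the family α ↦ Q α)
  ⟦∃⟧ : {A : Set} → (A → Subset X) → Subset X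
  ⟦∃⟧ Q = meet (λ P → meet (λ α → Q α ⇒ U P) ⇒ U P)

  -- A ↔ B := (A → B) ∧ (B → A)
  ⟦↔⟧ : Subset X → Subset X → Subset X
  ⟦↔⟧ a b = ⟦∧⟧ (a ⇒ b) (b ⇒ a)

  -- x =_A y := ∀ Q:(A → Prop). Q x ↔ Q y ; Q ranges over the
  -- set-theoretic function space  A → O(X)
  ⟦≡⟧ : {A : Set} → A → A → Subset X
  ⟦≡⟧ {A} x y = meet {J = A → I} (λ Q → ⟦↔⟧ (U (Q x)) (U (Q y)))

module Submission where

open import Data.Bool using (Bool; true; false)
open import Data.Product using (Σ; _×_; _,_; proj₁; proj₂)
open import Data.Sum using (inj₁; inj₂)
open import Data.Unit using (tt)
open import Relation.Binary.PropositionalEquality using (_≡_; refl; sym)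

open import Defs

-- Each impredicative connective has the shape ⋀_P ((c ⇒ P) ⇒ P) once its
-- antecedent is rewritten by the Heyting laws (currying, (a ⇒ P) ∧ (b ⇒ P) = a ∨ b ⇒ P,
-- ⋀_α (Q α ⇒ P) = ⋁ Q ⇒ P), and for an open c this meet is c itself:
-- instantiating P := c gives ≤ c, and c ≤ (c ⇒ P) ⇒ P for every P.
-- Leibniz equality is then decided by the open-valued predicate that is X at x and ∅ elsewhere.

module _ {X : Set} {A B C : Subset X} where

  ≐-trans : A ≐ B → B ≐ C → A ≐ C
  ≐-trans (A⊆B , B⊆A) (B⊆C , C⊆B) =
    (λ z z∈A → B⊆C z (A⊆B z z∈A)) , (λ z z∈C → B⊆A z (C⊆B z z∈C))

module OpenSetLogic (S : Space) where
  open Space S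
  open Sem S

  IsOpen : Subset X → Set
  IsOpen A = Σ I (λ k → U k ≐ A)

  U-isOpen : (i : I) → IsOpen (U i)
  U-isOpen i = i , (λ _ z → z) , (λ _ z → z)

  ∈-whole : (z : X) → z ∈ U (proj₁ whole-open)
  ∈-whole z = proj₂ (proj₂ whole-open) z tt

  ∩-isOpen : {a b : Subset X} → IsOpen a → IsOpen b → IsOpen (a ∩ b)
  ∩-isOpen (i , Ui⊆a , a⊆Ui) (j , Uj⊆b , b⊆Uj) with ∩-open i j
  ... | k , Uk⊆ , ⊆Uk =
    k , (λ z z∈Uk → let (z∈Ui , z∈Uj) = Uk⊆ z z∈Uk in Ui⊆a z z∈Ui , Uj⊆b z z∈Uj)
      , (λ z (z∈a , z∈b) → ⊆Uk z (a⊆Ui z z∈a , b⊆Uj z z∈b))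

  ∪-isOpen : {a b : Subset X} → IsOpen a → IsOpen b → IsOpen (a ∪ b)
  ∪-isOpen {a} {b} (i , Ui⊆a , a⊆Ui) (j , Uj⊆b , b⊆Uj) with ⋃-open Bool (λ { true → i ; false → j })
  ... | k , Uk⊆ , ⊆Uk = k , to , from
    where
    to : U k ⊆ (a ∪ b)
    to z z∈Uk with Uk⊆ z z∈Uk
    ... | true  , z∈Ui = inj₁ (Ui⊆a z z∈Ui)
    ... | false , z∈Uj = inj₂ (Uj⊆b z z∈Uj)
    from : (a ∪ b) ⊆ U k
    from z (inj₁ z∈a) = ⊆Uk z (true , a⊆Ui z z∈a)
    from z (inj₂ z∈b) = ⊆Uk z (false , b⊆Uj z z∈b)

  ⇒-isOpen : (a b : Subset X) → IsOpen (a ⇒ b)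
  ⇒-isOpen a b with ⋃-open (Σ I (λ t → (U t ∩ a) ⊆ b)) proj₁
  ... | k , Uk⊆ , ⊆Uk =
    k , (λ z z∈Uk → let ((t , t∩a⊆b) , z∈Ut) = Uk⊆ z z∈Uk in t , t∩a⊆b , z∈Ut)
      , (λ z (t , t∩a⊆b , z∈Ut) → ⊆Uk z ((t , t∩a⊆b) , z∈Ut))

  ⇒-elim : {a b : Subset X} {z : X} → z ∈ (a ⇒ b) → z ∈ a → z ∈ b
  ⇒-elim (t , t∩a⊆b , z∈t) z∈a = t∩a⊆b _ (z∈t , z∈a)

  ⇒-intro : {a b : Subset X} (t : I) → (U t ∩ a) ⊆ b → U t ⊆ (a ⇒ b)
  ⇒-intro t t∩a⊆b z z∈t = t , t∩a⊆b , z∈t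

  ⊆⇒⇒-whole : {a b : Subset X} → a ⊆ b → (z : X) → z ∈ (a ⇒ b)
  ⊆⇒⇒-whole a⊆b z = ⇒-intro (proj₁ whole-open) (λ w (_ , w∈a) → a⊆b w w∈a) z (∈-whole z)

  meet-elim : {J : Set} {f : J → Subset X} {z : X} → z ∈ meet f → (j : J) → z ∈ f j
  meet-elim (t , t⊆⋂ , z∈t) j = t⊆⋂ _ z∈t j

  meet-intro : {J : Set} {f : J → Subset X} (t : I) → ((j : J) → U t ⊆ f j) → U t ⊆ meet f
  meet-intro t t⊆f z z∈t = t , (λ w w∈t j → t⊆f j w w∈t) , z∈t

  meet-cong : {J : Set} {f g : J → Subset X} → ((j : J) → f j ≐ g j) → meet f ≐ meet g
  meet-cong f≐g =
      (λ z (t , t⊆⋂f , z∈t) → t , (λ w w∈t j → proj₁ (f≐g j) w (t⊆⋂f w w∈t j)) , z∈t)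
    , (λ z (t , t⊆⋂g , z∈t) → t , (λ w w∈t j → proj₂ (f≐g j) w (t⊆⋂g w w∈t j)) , z∈t)

  ⇒-congˡ : {a a′ : Subset X} (b : Subset X) → a ≐ a′ → (a ⇒ b) ≐ (a′ ⇒ b)
  ⇒-congˡ b (a⊆a′ , a′⊆a) =
      (λ z (t , t∩a⊆b , z∈t) → t , (λ w (w∈t , w∈a′) → t∩a⊆b w (w∈t , a′⊆a w w∈a′)) , z∈t)
    , (λ z (t , t∩a′⊆b , z∈t) → t , (λ w (w∈t , w∈a) → t∩a′⊆b w (w∈t , a⊆a′ w w∈a)) , z∈t)

  ⇒-curry : {a : Subset X} (b c : Subset X) → IsOpen a → (a ⇒ (b ⇒ c)) ≐ ((a ∩ b) ⇒ c)
  ⇒-curry {a} b c (i , Ui⊆a , a⊆Ui) = to , from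
    where
    to : (a ⇒ (b ⇒ c)) ⊆ ((a ∩ b) ⇒ c)
    to z (t , t∩a⊆b⇒c , z∈t) =
      t , (λ w (w∈t , w∈a , w∈b) → ⇒-elim (t∩a⊆b⇒c w (w∈t , w∈a)) w∈b) , z∈t
    from : ((a ∩ b) ⇒ c) ⊆ (a ⇒ (b ⇒ c))
    from z (t , t∩a∩b⊆c , z∈t) with ∩-open t i
    ... | k , Uk⊆ , ⊆Uk = t , (λ w (w∈t , w∈a) →
        ⇒-intro k (λ v (v∈k , v∈b) → let (v∈t , v∈i) = Uk⊆ v v∈k in t∩a∩b⊆c v (v∈t , Ui⊆a v v∈i , v∈b))
                w (⊆Uk w (w∈t , a⊆Ui w w∈a))) , z∈t

  ⇒-∩-≐-∪-⇒ : (a b c : Subset X) → ((a ⇒ c) ∩ (b ⇒ c)) ≐ ((a ∪ b) ⇒ c)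
  ⇒-∩-≐-∪-⇒ a b c = to , from
    where
    to : ((a ⇒ c) ∩ (b ⇒ c)) ⊆ ((a ∪ b) ⇒ c)
    to z ((s , s∩a⊆c , z∈s) , (t , t∩b⊆c , z∈t)) with ∩-open s t
    ... | k , Uk⊆ , ⊆Uk = k , case , ⊆Uk z (z∈s , z∈t)
      where
      case : (U k ∩ (a ∪ b)) ⊆ c
      case w (w∈k , inj₁ w∈a) = s∩a⊆c w (proj₁ (Uk⊆ w w∈k) , w∈a)
      case w (w∈k , inj₂ w∈b) = t∩b⊆c w (proj₂ (Uk⊆ w w∈k) , w∈b)
    from : ((a ∪ b) ⇒ c) ⊆ ((a ⇒ c) ∩ (b ⇒ c))
    from z (t , t∩a∪b⊆c , z∈t) =
        (t , (λ w (w∈t , w∈a) → t∩a∪b⊆c w (w∈t , inj₁ w∈a)) , z∈t)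
      , (t , (λ w (w∈t , w∈b) → t∩a∪b⊆c w (w∈t , inj₂ w∈b)) , z∈t)

  meet-⇒-≐-⋃-⇒ : {A : Set} (Q : A → Subset X) (c : Subset X) → meet (λ α → Q α ⇒ c) ≐ (⋃ Q ⇒ c)
  meet-⇒-≐-⋃-⇒ Q c =
      (λ z (t , t⊆⋂ , z∈t) → t , (λ w (w∈t , (α , w∈Qα)) → ⇒-elim (t⊆⋂ w w∈t α) w∈Qα) , z∈t)
    , (λ z (t , t∩⋃Q⊆c , z∈t) →
         meet-intro t (λ α → ⇒-intro t (λ w (w∈t , w∈Qα) → t∩⋃Q⊆c w (w∈t , (α , w∈Qα)))) z z∈t)

  meet-⇒⇒-≐ : {c : Subset X} → IsOpen c → meet (λ P → (c ⇒ U P) ⇒ U P) ≐ c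
  meet-⇒⇒-≐ (k , Uk⊆c , c⊆Uk) =
      (λ z z∈meet → Uk⊆c z (⇒-elim (meet-elim z∈meet k) (⊆⇒⇒-whole c⊆Uk z)))
    , (λ z z∈c → meet-intro k (λ P → ⇒-intro k (λ w (w∈k , w∈c⇒P) → ⇒-elim w∈c⇒P (Uk⊆c w w∈k)))
                   z (c⊆Uk z z∈c))

  ⟦⊥⟧≐∅ : ⟦⊥⟧ ≐ ∅
  ⟦⊥⟧≐∅ = (λ z z∈⊥ → proj₁ (proj₂ empty-open) z (meet-elim z∈⊥ (proj₁ empty-open))) , (λ _ ())

  ⟦∧⟧≐∩ : {a b : Subset X} → IsOpen a → IsOpen b → ⟦∧⟧ a b ≐ (a ∩ b)
  ⟦∧⟧≐∩ {b = b} a-open b-open = ≐-trans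
    (meet-cong (λ P → ⇒-congˡ (U P) (⇒-curry b (U P) a-open)))
    (meet-⇒⇒-≐ (∩-isOpen a-open b-open))

  ⟦∨⟧≐∪ : {a b : Subset X} → IsOpen a → IsOpen b → ⟦∨⟧ a b ≐ (a ∪ b)
  ⟦∨⟧≐∪ {a} {b} a-open b-open = ≐-trans
    (meet-cong (λ P → ≐-trans (⇒-curry (b ⇒ U P) (U P) (⇒-isOpen a (U P)))
                              (⇒-congˡ (U P) (⇒-∩-≐-∪-⇒ a b (U P)))))
    (meet-⇒⇒-≐ (∪-isOpen a-open b-open))

  ⟦∃⟧≐⋃ : {A : Set} (Q : A → I) → ⟦∃⟧ (λ α → U (Q α)) ≐ ⋃ (λ α → U (Q α))
  ⟦∃⟧≐⋃ {A} Q = ≐-trans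
    (meet-cong (λ P → ⇒-congˡ (U P) (meet-⇒-≐-⋃-⇒ (λ α → U (Q α)) (U P))))
    (meet-⇒⇒-≐ (⋃-open A Q))

  ⟦↔⟧-whole→≐ : {a b : Subset X} → IsOpen a → IsOpen b → ⟦↔⟧ a b ≐ Whole → a ≐ b
  ⟦↔⟧-whole→≐ {a} {b} a-open b-open (_ , Whole⊆↔) =
      (λ z z∈a → ⇒-elim (proj₁ (↔⊆ z)) z∈a)
    , (λ z z∈b → ⇒-elim (proj₂ (↔⊆ z)) z∈b)
    where
    ↔⊆ : (z : X) → z ∈ ((a ⇒ b) ∩ (b ⇒ a))
    ↔⊆ z = proj₁ (⟦∧⟧≐∩ (⇒-isOpen a b) (⇒-isOpen b a)) z (Whole⊆↔ z tt)

  ⟦≡⟧-whole→≡ : {A : Set} (x y : A) → ⟦≡⟧ x y ≐ Whole → x ≡ y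
  ⟦≡⟧-whole→≡ {A} x y (_ , Whole⊆≡) with proj₁ (is-x≐ y) p (proj₁ is-x-x≐is-x-y p p∈is-x-x)
    where
    is-x : A → I
    is-x z = proj₁ (⋃-open (z ≡ x) (λ _ → proj₁ whole-open))
    is-x≐ : (z : A) → U (is-x z) ≐ ⋃ (λ (_ : z ≡ x) → U (proj₁ whole-open))
    is-x≐ z = proj₂ (⋃-open (z ≡ x) (λ _ → proj₁ whole-open))
    p∈is-x-x : p ∈ U (is-x x)
    p∈is-x-x = proj₂ (is-x≐ x) p (refl , ∈-whole p)
    is-x-x≐is-x-y : U (is-x x) ≐ U (is-x y)
    is-x-x≐is-x-y = ⟦↔⟧-whole→≐ (U-isOpen (is-x x)) (U-isOpen (is-x y))
      ((λ _ _ → tt) , (λ z _ → meet-elim (Whole⊆≡ z tt) is-x))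
  ... | y≡x , _ = sym y≡x

open Space
open Sem

theorem3 : (S : Space) →
    (⟦⊥⟧ S ≐ ∅)
    × ((a b : I S) → ⟦∧⟧ S (U S a) (U S b) ≐ (U S a ∩ U S b))
    × ((a b : I S) → ⟦∨⟧ S (U S a) (U S b) ≐ (U S a ∪ U S b))
    × ((A : Set) (Q : A → I S) → ⟦∃⟧ S (λ α → U S (Q α)) ≐ ⋃ (λ α → U S (Q α)))
    × ((a b : I S) → ⟦↔⟧ S (U S a) (U S b) ≐ Whole → U S a ≐ U S b)
    × ((A : Set) (x y : A) → ⟦≡⟧ S x y ≐ Whole → x ≡ y)
theorem3 S =
    ⟦⊥⟧≐∅
  , (λ a b → ⟦∧⟧≐∩ (U-isOpen a) (U-isOpen b))
  , (λ a b → ⟦∨⟧≐∪ (U-isOpen a) (U-isOpen b))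
  , (λ A → ⟦∃⟧≐⋃)
  , (λ a b → ⟦↔⟧-whole→≐ (U-isOpen a) (U-isOpen b))
  , (λ A → ⟦≡⟧-whole→≡)
  where open OpenSetLogic S
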